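{- Let $G$ be a finite, simple, undirected, connected graph, and let $\{u,v\}\in E(G)$ be an edge such that $v$ is a leaf (degree $1$) and $u$ is not a leaf. If $M$ is a monitoring edge-geodetic set of $G$, then $M\setminus\{u\}$ is also a monitoring edge-geodetic set of $G$.
   Context: An edge $\{a,b\}\in E(G)$ is monitored by a pair of vertices $\{x,y\}$ (with $x,y\in V(G)$) if $\{a,b\}$ lies on every shortest path from $x$ to $y$ in $G$. A monitoring edge-geodetic set (MEG-set) of $G$ is a subset $M\subseteq V(G)$ such that every edge of $G$ is monitored by some pair $\{x,y\}$ with $x,y\in M$. -}

module Defs where

open import Data.Nat using (ℕ; zero; suc; _≤_; _+_)
open import Data.Bool using (Bool; true; false; T)
open import Data.Fin using (Fin)
open import Data.Fin.Subset using (Subset; _∈_)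
open import Data.List using (List; map; allFin)
open import Data.Nat.ListAction using (sum)
open import Data.Product using (_×_; Σ-syntax)
open import Data.Sum using (_⊎_)
open import Data.Empty using (⊥)
open import Relation.Binary.PropositionalEquality using (_≡_)

record Graph (n : ℕ) : Set where
  field
    adj     : Fin n → Fin n → Bool
    adj-sym : ∀ x y → adj x y ≡ adj y x
    irrefl  : ∀ x → adj x x ≡ false

module _ {n : ℕ} (G : Graph n) where
  open Graph G

  Adj : Fin n → Fin n → Set
  Adj a b = T (adj a b)

  -- Walks from x to y (a shortest walk is automatically a path).
  data Walk : Fin n → Fin n → Set where
    []  : ∀ {x} → Walk x x
    _∷_ : ∀ {x y z} → Adj x y → Walk y z → Walk x z

  len : ∀ {x y} → Walk x y → ℕ
  len []       = zero
  len (_ ∷ w)  = suc (len w)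

  data EdgeOn (a b : Fin n) : ∀ {x y} → Walk x y → Set where
    here  : ∀ {x y z} (e : Adj x y) (w : Walk y z) →
            (x ≡ a × y ≡ b) ⊎ (x ≡ b × y ≡ a) → EdgeOn a b (e ∷ w)
    there : ∀ {x y z} (e : Adj x y) (w : Walk y z) →
            EdgeOn a b w → EdgeOn a b (e ∷ w)

  IsShortest : ∀ {x y} → Walk x y → Set
  IsShortest {x} {y} p = ∀ (q : Walk x y) → len p ≤ len q

  Connected : Set
  Connected = ∀ x y → Walk x y

  bit : Bool → ℕ
  bit true  = 1
  bit false = 0

  degree : Fin n → ℕ
  degree v = sum (map (λ w → bit (adj v w)) (allFin n))

  IsLeaf : Fin n → Set
  IsLeaf v = degree v ≡ 1

  Monitors : Fin n → Fin n → Fin n → Fin n → Set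
  Monitors x y a b = ∀ (p : Walk x y) → IsShortest p → EdgeOn a b p

  IsMEG : Subset n → Set
  IsMEG M = ∀ a b → Adj a b →
            Σ[ x ∈ Fin n ] Σ[ y ∈ Fin n ] (x ∈ M × y ∈ M × Monitors x y a b)

-- A shortest path through the pendant edge uv must have the leaf v as an endpoint, so v lies
-- in every MEG-set. Every walk from v starts with the edge vu, so whatever a pair {u, y} with
-- y ≠ v monitors is monitored by {v, y} as well. The pair {u, v} itself monitors only the edge uv, and uv is
-- also monitored by v together with any z ∈ M outside {u, v}; such a z exists because u has
-- a second neighbour w, and no pair inside {u, v} monitors the edge uw.
module Submission where

open import Defs
open import Data.Nat using (ℕ; zero; suc; _≤_; _<_; _+_; z≤n; s≤s)
open import Data.Nat.Properties
  using (≤-trans; ≤-reflexive; +-comm; +-suc; +-identityʳ; m≤m+n; m≤n+m; +-monoʳ-≤;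
         n≤1+n; ≤-pred; ≮⇒≥; <⇒≱; 1+n≰n; module ≤-Reasoning)
open import Data.Nat.Induction using (<-wellFounded)
open import Data.Fin using (Fin; zero; suc; toℕ; fromℕ<; _≟_)
open import Data.Fin.Properties using (any?; suc-injective; toℕ<n; toℕ-fromℕ<)
open import Data.Fin.Subset using (Subset; _-_; _∈_)
open import Data.Fin.Subset.Properties using (x∈p∧x∉q⇒x∈p─q; x≢y⇒x∉⁅y⁆)
open import Data.Bool using (true; false; T)
open import Data.Bool.Properties using (T?)
open import Data.List using (tabulate)
open import Data.List.Properties using (map-tabulate)
open import Data.Nat.ListAction using (sum)
open import Data.Product using (Σ-syntax; _×_; _,_)
open import Data.Sum using (_⊎_; inj₁; inj₂)
open import Data.Empty using (⊥-elim)
open import Data.Unit using (tt)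
open import Function using (_∘_; id; _on_)
open import Induction.WellFounded using (WfRec; module All)
open import Relation.Binary.Construct.On using (wellFounded)
open import Relation.Nullary using (¬_; Dec; yes; no; contradiction)
open import Relation.Nullary.Decidable using (map′; _×-dec_; _⊎-dec_; ¬?)
open import Relation.Binary.PropositionalEquality
  using (_≡_; _≢_; refl; sym; trans; cong; cong₂; subst; module ≡-Reasoning)

sum-tabulate-≡0 : ∀ {n} (g : Fin n → ℕ) → (∀ i → g i ≡ 0) → sum (tabulate g) ≡ 0
sum-tabulate-≡0 {zero}  g g≡0 = refl
sum-tabulate-≡0 {suc n} g g≡0 rewrite g≡0 zero = sum-tabulate-≡0 (g ∘ suc) (g≡0 ∘ suc)

sum-tabulate-supported : ∀ {n} (g : Fin n → ℕ) (i : Fin n) →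
                         (∀ j → j ≢ i → g j ≡ 0) → sum (tabulate g) ≡ g i
sum-tabulate-supported g zero g≡0 = begin
  g zero + sum (tabulate (g ∘ suc)) ≡⟨ cong (g zero +_) (sum-tabulate-≡0 (g ∘ suc) λ j → g≡0 (suc j) λ ()) ⟩
  g zero + 0                        ≡⟨ +-identityʳ (g zero) ⟩
  g zero                            ∎
  where open ≡-Reasoning
sum-tabulate-supported g (suc i) g≡0 rewrite g≡0 zero (λ ()) =
  sum-tabulate-supported (g ∘ suc) i λ j j≢i → g≡0 (suc j) (j≢i ∘ suc-injective)

≤-sum-tabulate : ∀ {n} (g : Fin n → ℕ) (i : Fin n) → g i ≤ sum (tabulate g)
≤-sum-tabulate g zero    = m≤m+n (g zero) _
≤-sum-tabulate g (suc i) = ≤-trans (≤-sum-tabulate (g ∘ suc) i) (m≤n+m _ (g zero))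

+-≤-sum-tabulate : ∀ {n} (g : Fin n → ℕ) {i j : Fin n} → i ≢ j → g i + g j ≤ sum (tabulate g)
+-≤-sum-tabulate g {zero}  {zero}  i≢j = contradiction refl i≢j
+-≤-sum-tabulate g {zero}  {suc j} _   = +-monoʳ-≤ (g zero) (≤-sum-tabulate (g ∘ suc) j)
+-≤-sum-tabulate g {suc i} {zero}  _   =
  ≤-trans (≤-reflexive (+-comm (g (suc i)) (g zero))) (+-monoʳ-≤ (g zero) (≤-sum-tabulate (g ∘ suc) i))
+-≤-sum-tabulate g {suc i} {suc j} i≢j =
  ≤-trans (+-≤-sum-tabulate (g ∘ suc) (i≢j ∘ cong suc)) (m≤n+m _ (g zero))

SameEdge : ∀ {A : Set} → A → A → A → A → Set
SameEdge x y a b = (x ≡ a × y ≡ b) ⊎ (x ≡ b × y ≡ a)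

SameEdge-swap : ∀ {A : Set} {x y a b : A} → SameEdge x y a b → SameEdge y x a b
SameEdge-swap (inj₁ (x≡a , y≡b)) = inj₂ (y≡b , x≡a)
SameEdge-swap (inj₂ (x≡b , y≡a)) = inj₁ (y≡a , x≡b)

module _ {n : ℕ} (G : Graph n) where
  open Graph G

  Monitored : Subset n → Fin n → Fin n → Set
  Monitored M a b = Σ[ x ∈ Fin n ] Σ[ y ∈ Fin n ] (x ∈ M × y ∈ M × Monitors G x y a b)

  Adj-sym : ∀ {x y} → Adj G x y → Adj G y x
  Adj-sym {x} {y} = subst T (adj-sym x y)

  Adj⇒≢ : ∀ {x y} → Adj G x y → x ≢ y
  Adj⇒≢ {x} xx refl = subst T (irrefl x) xx

  reverse-onto : ∀ {x y z} → Walk G x y → Walk G x z → Walk G y z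
  reverse-onto []      acc = acc
  reverse-onto (e ∷ w) acc = reverse-onto w (Adj-sym e ∷ acc)

  reverse : ∀ {x y} → Walk G x y → Walk G y x
  reverse w = reverse-onto w []

  len-reverse-onto : ∀ {x y z} (w : Walk G x y) (acc : Walk G x z) →
                     len G (reverse-onto w acc) ≡ len G w + len G acc
  len-reverse-onto []      acc = refl
  len-reverse-onto (e ∷ w) acc =
    trans (len-reverse-onto w (Adj-sym e ∷ acc)) (+-suc (len G w) (len G acc))

  len-reverse : ∀ {x y} (w : Walk G x y) → len G (reverse w) ≡ len G w
  len-reverse w = trans (len-reverse-onto w []) (+-identityʳ (len G w))

  EdgeOn-reverse-onto : ∀ {a b x y z} (w : Walk G x y) (acc : Walk G x z) →
                        EdgeOn G a b (reverse-onto w acc) → EdgeOn G a b w ⊎ EdgeOn G a b acc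
  EdgeOn-reverse-onto []      acc o = inj₂ o
  EdgeOn-reverse-onto (e ∷ w) acc o with EdgeOn-reverse-onto w (Adj-sym e ∷ acc) o
  ... | inj₁ o′              = inj₁ (there e w o′)
  ... | inj₂ (here _ _ same) = inj₁ (here e w (SameEdge-swap same))
  ... | inj₂ (there _ _ o′)  = inj₂ o′

  EdgeOn-reverse : ∀ {a b x y} (w : Walk G x y) → EdgeOn G a b (reverse w) → EdgeOn G a b w
  EdgeOn-reverse w o with EdgeOn-reverse-onto w [] o
  ... | inj₁ o′ = o′
  ... | inj₂ ()

  reverse-shortest : ∀ {x y} (p : Walk G x y) → IsShortest G p → IsShortest G (reverse p)
  reverse-shortest p p-shortest q = begin
    len G (reverse p) ≡⟨ len-reverse p ⟩
    len G p           ≤⟨ p-shortest (reverse q) ⟩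
    len G (reverse q) ≡⟨ len-reverse q ⟩
    len G q           ∎
    where open ≤-Reasoning

  ≢⇒1≤len : ∀ {x y} → x ≢ y → (w : Walk G x y) → 1 ≤ len G w
  ≢⇒1≤len x≢y []      = contradiction refl x≢y
  ≢⇒1≤len x≢y (_ ∷ _) = s≤s z≤n

  walk-of-length? : ∀ k x y → Dec (Σ[ w ∈ Walk G x y ] len G w ≡ k)
  walk-of-length? zero x y with x ≟ y
  ... | yes refl = yes ([] , refl)
  ... | no x≢y   = no λ { ([] , _) → x≢y refl ; (_ ∷ _ , ()) }
  walk-of-length? (suc k) x y with any? (λ z → T? (adj x z) ×-dec walk-of-length? k z y)
  ... | yes (_ , e , w , refl) = yes (e ∷ w , refl)
  ... | no none = no λ { ([] , ()) ; (e ∷ w , refl) → none (_ , e , w , refl) }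

  shorter-walk? : ∀ {x y} (w : Walk G x y) → Dec (Σ[ q ∈ Walk G x y ] len G q < len G w)
  shorter-walk? {x} {y} w = map′ from to (any? λ (k : Fin (len G w)) → walk-of-length? (toℕ k) x y)
    where
    from : Σ[ k ∈ Fin (len G w) ] Σ[ q ∈ Walk G x y ] len G q ≡ toℕ k →
           Σ[ q ∈ Walk G x y ] len G q < len G w
    from (k , q , q≡k) = q , subst (_< len G w) (sym q≡k) (toℕ<n k)
    to : Σ[ q ∈ Walk G x y ] len G q < len G w →
         Σ[ k ∈ Fin (len G w) ] Σ[ q ∈ Walk G x y ] len G q ≡ toℕ k
    to (q , q<w) = fromℕ< q<w , q , sym (toℕ-fromℕ< q<w)

  shortest-walk : ∀ {x y} → Walk G x y → Σ[ p ∈ Walk G x y ] IsShortest G p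
  shortest-walk {x} {y} = All.wfRec (wellFounded (len G) <-wellFounded) _ Shortest step
    where
    Shortest : Walk G x y → Set
    Shortest _ = Σ[ p ∈ Walk G x y ] IsShortest G p
    step : ∀ w → WfRec (_<_ on len G) Shortest w → Shortest w
    step w shorter with shorter-walk? w
    ... | yes (q , q<w) = shorter q<w
    ... | no none       = w , λ q → ≮⇒≥ λ q<w → none (q , q<w)

  Monitors-sym : ∀ {x y a b} → Monitors G x y a b → Monitors G y x a b
  Monitors-sym mon p p-shortest = EdgeOn-reverse p (mon (reverse p) (reverse-shortest p p-shortest))

  ¬Monitors-refl : ∀ {x a b} → ¬ Monitors G x x a b
  ¬Monitors-refl mon with mon [] (λ _ → z≤n)
  ... | ()

  Monitors-adjacent⇒SameEdge : ∀ {x y a b} → Adj G x y → Monitors G x y a b → SameEdge x y a b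
  Monitors-adjacent⇒SameEdge e mon with mon (e ∷ []) (≢⇒1≤len (Adj⇒≢ e))
  ... | here _ _ same = same
  ... | there _ _ ()

  bit-T : ∀ {b} → T b → bit G b ≡ 1
  bit-T {true} _ = refl

  bit-¬T : ∀ {b} → ¬ T b → bit G b ≡ 0
  bit-¬T {true}  ¬t = contradiction tt ¬t
  bit-¬T {false} _  = refl

  degree-≡-sum : ∀ x → degree G x ≡ sum (tabulate (bit G ∘ adj x))
  degree-≡-sum x = cong sum (map-tabulate id (bit G ∘ adj x))

  leaf-neighbour-unique : ∀ {x y z} → IsLeaf G x → Adj G x y → Adj G x z → y ≡ z
  leaf-neighbour-unique {x} {y} {z} x-leaf xy xz with y ≟ z
  ... | yes y≡z = y≡z
  ... | no y≢z  = contradiction (subst (2 ≤_) x-leaf two≤degree) (1+n≰n {1})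
    where
    open ≤-Reasoning
    two≤degree : 2 ≤ degree G x
    two≤degree = begin
      2                                 ≡⟨ cong₂ _+_ (sym (bit-T xy)) (sym (bit-T xz)) ⟩
      bit G (adj x y) + bit G (adj x z) ≤⟨ +-≤-sum-tabulate (bit G ∘ adj x) y≢z ⟩
      sum (tabulate (bit G ∘ adj x))    ≡⟨ degree-≡-sum x ⟨
      degree G x                        ∎

  ¬leaf⇒another-neighbour : ∀ {x y} → Adj G x y → ¬ IsLeaf G x → Σ[ z ∈ Fin n ] (Adj G x z × z ≢ y)
  ¬leaf⇒another-neighbour {x} {y} xy x-nonleaf with any? (λ z → T? (adj x z) ×-dec ¬? (z ≟ y))
  ... | yes found = found
  ... | no none   = contradiction x-leaf x-nonleaf
    where
    open ≡-Reasoning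
    x-leaf : IsLeaf G x
    x-leaf = begin
      degree G x                     ≡⟨ degree-≡-sum x ⟩
      sum (tabulate (bit G ∘ adj x)) ≡⟨ sum-tabulate-supported _ y (λ z z≢y → bit-¬T λ xz → none (z , xz , z≢y)) ⟩
      bit G (adj x y)                ≡⟨ bit-T xy ⟩
      1                              ∎

module Pendant {n : ℕ} (G : Graph n) {u v : Fin n} (uv : Adj G u v) (v-leaf : IsLeaf G v) where

  leaf-neighbour : ∀ {w} → Adj G v w → w ≡ u
  leaf-neighbour vw = leaf-neighbour-unique G v-leaf vw (Adj-sym G uv)

  v≢u : v ≢ u
  v≢u = Adj⇒≢ G (Adj-sym G uv)

  -- A walk that passes through v without ending there contains u, v, u and can be shortened.
  shortcut : ∀ {x y} (p : Walk G x y) → EdgeOn G u v p → x ≢ v → y ≢ v →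
             Σ[ q ∈ Walk G x y ] len G q < len G p
  shortcut (_∷_ {y = y₁} e w) o x≢v y≢v with y₁ ≟ v
  shortcut (e ∷ []) _ _ y≢v | yes refl = contradiction refl y≢v
  shortcut (e ∷ (f ∷ w)) _ _ _ | yes refl with leaf-neighbour (Adj-sym G e) | leaf-neighbour f
  ... | refl | refl = w , n≤1+n _
  shortcut (e ∷ w) (here .e .w (inj₁ (_ , y₁≡v))) _ _ | no y₁≢v = contradiction y₁≡v y₁≢v
  shortcut (e ∷ w) (here .e .w (inj₂ (x≡v , _))) x≢v _ | no _ = contradiction x≡v x≢v
  shortcut (e ∷ w) (there .e .w o) _ y≢v | no y₁≢v =
    let q , q<w = shortcut w o y₁≢v y≢v in e ∷ q , s≤s q<w

  leaf∈MEG : Connected G → ∀ {M} → IsMEG G M → v ∈ M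
  leaf∈MEG connected M-meg with M-meg u v uv
  ... | x , y , x∈M , y∈M , mon with x ≟ v | y ≟ v
  ... | yes refl | _        = x∈M
  ... | no _     | yes refl = y∈M
  ... | no x≢v   | no y≢v   =
    let p , p-shortest = shortest-walk G (connected x y)
        q , q<p = shortcut p (mon p p-shortest) x≢v y≢v
    in contradiction (p-shortest q) (<⇒≱ q<p)

  Monitors-from-leaf : ∀ {y a b} → Monitors G u y a b → y ≢ v → Monitors G v y a b
  Monitors-from-leaf mon y≢v []      _          = contradiction refl y≢v
  Monitors-from-leaf mon y≢v (e ∷ w) p-shortest with leaf-neighbour e
  ... | refl = there e w (mon w λ q → ≤-pred (p-shortest (e ∷ q)))

  Monitors-leaf-edge : ∀ {z a b} → z ≢ v → SameEdge u v a b → Monitors G v z a b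
  Monitors-leaf-edge z≢v same []      _ = contradiction refl z≢v
  Monitors-leaf-edge z≢v same (e ∷ w) _ with leaf-neighbour e
  ... | refl = here e w (SameEdge-swap same)

  ¬SameEdge-leaf-edge : ∀ {w} → w ≢ v → ¬ SameEdge u v u w
  ¬SameEdge-leaf-edge w≢v (inj₁ (_ , v≡w)) = w≢v (sym v≡w)
  ¬SameEdge-leaf-edge w≢v (inj₂ (_ , v≡u)) = v≢u v≡u

  Endpoint : Fin n → Set
  Endpoint x = x ≡ u ⊎ x ≡ v

  endpoint? : ∀ x → Dec (Endpoint x)
  endpoint? x = (x ≟ u) ⊎-dec (x ≟ v)

  ¬Monitors-from-endpoints : ∀ {w x y} → w ≢ v → Endpoint x → Endpoint y → ¬ Monitors G x y u w
  ¬Monitors-from-endpoints _   (inj₁ refl) (inj₁ refl) = ¬Monitors-refl G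
  ¬Monitors-from-endpoints _   (inj₂ refl) (inj₂ refl) = ¬Monitors-refl G
  ¬Monitors-from-endpoints w≢v (inj₁ refl) (inj₂ refl) =
    ¬SameEdge-leaf-edge w≢v ∘ Monitors-adjacent⇒SameEdge G uv
  ¬Monitors-from-endpoints w≢v (inj₂ refl) (inj₁ refl) =
    ¬SameEdge-leaf-edge w≢v ∘ Monitors-adjacent⇒SameEdge G uv ∘ Monitors-sym G

module RemoveLeafNeighbour {n : ℕ} (G : Graph n) (connected : Connected G) {u v : Fin n}
    (uv : Adj G u v) (v-leaf : IsLeaf G v) (u-nonleaf : ¬ IsLeaf G u)
    {M : Subset n} (M-meg : IsMEG G M) where
  open Pendant G uv v-leaf

  ∈-minus : ∀ {x} → x ∈ M → x ≢ u → x ∈ M - u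
  ∈-minus x∈M x≢u = x∈p∧x∉q⇒x∈p─q x∈M (x≢y⇒x∉⁅y⁆ x≢u)

  member-off-endpoints : Σ[ z ∈ Fin n ] (z ∈ M × ¬ Endpoint z)
  member-off-endpoints with ¬leaf⇒another-neighbour G uv u-nonleaf
  ... | w , uw , w≢v with M-meg u w uw
  ... | x , y , x∈M , y∈M , mon with endpoint? x | endpoint? y
  ... | no x-off    | _           = x , x∈M , x-off
  ... | yes _       | no y-off    = y , y∈M , y-off
  ... | yes x-end   | yes y-end   = ⊥-elim (¬Monitors-from-endpoints w≢v x-end y-end mon)

  v∈M-u : v ∈ M - u
  v∈M-u = ∈-minus (leaf∈MEG connected M-meg) v≢u

  Monitored-replacing-u : ∀ {y a b} → y ∈ M → Monitors G u y a b → Monitored G (M - u) a b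
  Monitored-replacing-u {y} y∈M mon with y ≟ u | y ≟ v
  ... | yes refl | _        = ⊥-elim (¬Monitors-refl G mon)
  ... | no _     | yes refl =
    let z , z∈M , z-off = member-off-endpoints
    in v , z , v∈M-u , ∈-minus z∈M (z-off ∘ inj₁) ,
       Monitors-leaf-edge (z-off ∘ inj₂) (Monitors-adjacent⇒SameEdge G uv mon)
  ... | no y≢u   | no y≢v   = v , y , v∈M-u , ∈-minus y∈M y≢u , Monitors-from-leaf mon y≢v

  Monitored-without-u : ∀ {a b} → Monitored G M a b → Monitored G (M - u) a b
  Monitored-without-u (x , y , x∈M , y∈M , mon) with x ≟ u | y ≟ u
  ... | yes refl | _        = Monitored-replacing-u y∈M mon
  ... | no _     | yes refl = Monitored-replacing-u x∈M (Monitors-sym G mon)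
  ... | no x≢u   | no y≢u   = x , y , ∈-minus x∈M x≢u , ∈-minus y∈M y≢u , mon

lemma2 : ∀ {n : ℕ} (G : Graph n) → Connected G →
         (u v : Fin n) → Adj G u v → IsLeaf G v → ¬ IsLeaf G u →
         (M : Subset n) → IsMEG G M → IsMEG G (M - u)
lemma2 G connected u v uv v-leaf u-nonleaf M M-meg a b ab = Monitored-without-u (M-meg a b ab)
  where open RemoveLeafNeighbour G connected uv v-leaf u-nonleaf M-meg
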